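{- For $n>0$, the $2$-polygraph $\mathrm{PreCol}_2(n)$ is Tietze equivalent to the $2$-polygraph $\mathrm{CPC}_2(n)$.
   Context: Let $[n]=\{1<\dots<n\}$; a column is a word $x_p\dots x_1$ with $x_p>\dots>x_1$, $\mathrm{col}(n)$ the set of nonempty columns, and $\mathrm{Col}_1(n)=\{c_u\mid u\in\mathrm{col}(n)\}$. Let $\mathrm{PC}_2(n)$ consist of the relations $\alpha'_{x,zy}:c_xc_{zy}\Rightarrow c_{zx}c_y$ for $1\le x\le y<z\le n$ and $\alpha'_{y,zx}:c_yc_{zx}\Rightarrow c_{yx}c_z$ for $1\le x<y\le z\le n$. $\mathrm{CPC}_2(n)$ has generators $\mathrm{Col}_1(n)$ and relations $\mathrm{PC}_2(n)$ together with $\gamma_u:c_{x_p}\cdots c_{x_1}\Rightarrow c_u$ for every column $u=x_p\dots x_1$ with $p\ge2$. $\mathrm{PreCol}_2(n)$ has generators $\mathrm{Col}_1(n)$ and relations $\mathrm{PC}_2(n)$ together with $\alpha'_{x,u}:c_xc_u\Rightarrow c_{xu}$ for every $x\in[n]$, $u\in\mathrm{col}(n)$ with $xu\in\mathrm{col}(n)$. Two $2$-polygraphs are Tietze equivalent if they present isomorphic monoids, where a $2$-polygraph presents the quotient of the free monoid on its generators by the congruence generated by its relations. -}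

module Defs where

open import Data.Nat using (ℕ; zero; suc; _≤_; _<_; _≤ᵇ_; _<ᵇ_)
open import Data.Bool using (Bool; true; false; _∧_; T)
open import Data.List using (List; []; _∷_; _++_; map; length; [_])
open import Data.Product using (Σ; _×_; proj₁)
open import Data.Sum using (_⊎_)
open import Relation.Binary.PropositionalEquality using (_≡_)

-- Columns over [n] = {1 < ... < n}.
-- A column x_p ... x_1 (x_p > ... > x_1) is represented by the list
-- x_p ∷ ... ∷ x_1 ∷ [] of natural numbers in {1,...,n}.

inRange : ℕ → ℕ → Bool
inRange n x = (1 ≤ᵇ x) ∧ (x ≤ᵇ n)

allB : (ℕ → Bool) → List ℕ → Bool
allB p [] = true
allB p (x ∷ r) = p x ∧ allB p r

strictDecr : List ℕ → Bool
strictDecr [] = true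
strictDecr (x ∷ []) = true
strictDecr (x ∷ y ∷ r) = (y <ᵇ x) ∧ strictDecr (y ∷ r)

isCol : ℕ → List ℕ → Bool
isCol n [] = false
isCol n (x ∷ r) = allB (inRange n) (x ∷ r) ∧ strictDecr (x ∷ r)

Col : ℕ → Set
Col n = Σ (List ℕ) (λ u → T (isCol n u))

Word : ℕ → Set
Word n = List (Col n)

data Cong {A : Set} (R : List A → List A → Set) : List A → List A → Set where
  step   : ∀ u l r v → R l r → Cong R (u ++ l ++ v) (u ++ r ++ v)
  c-refl : ∀ w → Cong R w w
  c-sym  : ∀ {w w'} → Cong R w w' → Cong R w' w
  c-trans : ∀ {w w' w''} → Cong R w w' → Cong R w' w'' → Cong R w w''

-- The presented monoids List A / Cong R and List B / Cong S are isomorphic: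
-- a monoid morphism f between the quotients with an inverse morphism g
-- (given by functions on representatives respecting the congruences).
TietzeEquivalent : {A B : Set} → (List A → List A → Set) → (List B → List B → Set) → Set
TietzeEquivalent {A} {B} R S =
  Σ (List A → List B) λ f → Σ (List B → List A) λ g →
    (∀ u v → Cong R u v → Cong S (f u) (f v)) ×
    (∀ u v → Cong S u v → Cong R (g u) (g v)) ×
    Cong S (f []) [] ×
    (∀ u v → Cong S (f (u ++ v)) (f u ++ f v)) ×
    Cong R (g []) [] ×
    (∀ u v → Cong R (g (u ++ v)) (g u ++ g v)) ×
    (∀ u → Cong R (g (f u)) u) ×
    (∀ v → Cong S (f (g v)) v)

data PC2 (n : ℕ) : Word n → Word n → Set where
  α-x,zy : ∀ x y z → 1 ≤ x → x ≤ y → y < z → z ≤ n →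
           (cx czy czx cy : Col n) →
           proj₁ cx ≡ [ x ] → proj₁ czy ≡ z ∷ y ∷ [] →
           proj₁ czx ≡ z ∷ x ∷ [] → proj₁ cy ≡ [ y ] →
           PC2 n (cx ∷ czy ∷ []) (czx ∷ cy ∷ [])
  α-y,zx : ∀ x y z → 1 ≤ x → x < y → y ≤ z → z ≤ n →
           (cy czx cyx cz : Col n) →
           proj₁ cy ≡ [ y ] → proj₁ czx ≡ z ∷ x ∷ [] →
           proj₁ cyx ≡ y ∷ x ∷ [] → proj₁ cz ≡ [ z ] →
           PC2 n (cy ∷ czx ∷ []) (cyx ∷ cz ∷ [])

-- CPC₂(n): PC₂(n) together with
-- γ_u : c_{x_p} ⋯ c_{x_1} ⇒ c_u  for every column u = x_p…x_1 with p ≥ 2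

data CPCRel (n : ℕ) : Word n → Word n → Set where
  pc : ∀ {l r} → PC2 n l r → CPCRel n l r
  γ  : (u : Col n) (w : Word n) → 2 ≤ length (proj₁ u) →
       map proj₁ w ≡ map [_] (proj₁ u) →
       CPCRel n w (u ∷ [])

data PreColRel (n : ℕ) : Word n → Word n → Set where
  pc : ∀ {l r} → PC2 n l r → PreColRel n l r
  α-x,u : ∀ x → (cx cu cxu : Col n) →
          proj₁ cx ≡ [ x ] → proj₁ cxu ≡ x ∷ proj₁ cu →
          PreColRel n (cx ∷ cu ∷ []) (cxu ∷ [])

module Submission where

-- PreCol₂(n) and CPC₂(n) have the same generators Col₁(n) and share the
-- relations PC₂(n); they differ only in how a column c_u is built from
-- its letters.  We show that the two sets of relations generate the SAME
-- congruence on the free monoid over Col₁(n), so the identity map is a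
-- Tietze equivalence.

open import Defs
open import Data.Nat using (ℕ; _<_; _<ᵇ_; s≤s; z≤n)
open import Data.Bool using (_∧_; T)
open import Data.Bool.Properties using (T-∧; T-irrelevant)
open import Data.List using (List; []; _∷_; _++_; map; [_])
open import Data.List.Properties using (++-assoc; ++-identityʳ; ∷-injectiveˡ; ∷-injectiveʳ)
open import Data.Product using (_×_; _,_; proj₁; proj₂)
open import Data.Unit using (tt)
open import Function using (Equivalence)
open import Relation.Binary.PropositionalEquality
  using (_≡_; refl; sym; trans; cong; cong₂; subst; subst₂)

∧-split : ∀ {a b} → T (a ∧ b) → T a × T b
∧-split = Equivalence.to T-∧

∧-join : ∀ {a b} → T a → T b → T (a ∧ b)
∧-join p q = Equivalence.from T-∧ (p , q)

module _ {A : Set} {R : List A → List A → Set} where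

  inContext : ∀ a b {w w'} → Cong R w w' → Cong R (a ++ w ++ b) (a ++ w' ++ b)
  inContext a b (step u l r v ρ) = subst₂ (Cong R) (reassoc l) (reassoc r) (step (a ++ u) l r (v ++ b) ρ)
    where
    reassoc : ∀ m → (a ++ u) ++ m ++ v ++ b ≡ a ++ (u ++ m ++ v) ++ b
    reassoc m = trans (++-assoc a u (m ++ v ++ b))
      (cong (a ++_) (trans (cong (u ++_) (sym (++-assoc m v b))) (sym (++-assoc u (m ++ v) b))))
  inContext a b (c-refl w) = c-refl _
  inContext a b (c-sym c) = c-sym (inContext a b c)
  inContext a b (c-trans c d) = c-trans (inContext a b c) (inContext a b d)

  prepend : ∀ a {w w'} → Cong R w w' → Cong R (a ∷ w) (a ∷ w')
  prepend a (step u l r v ρ) = step (a ∷ u) l r v ρ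
  prepend a (c-refl w) = c-refl _
  prepend a (c-sym c) = c-sym (prepend a c)
  prepend a (c-trans c d) = c-trans (prepend a c) (prepend a d)

  relation : ∀ {l r} → R l r → Cong R l r
  relation {l} {r} ρ = subst₂ (Cong R) (++-identityʳ l) (++-identityʳ r) (step [] l r [] ρ)

Derivable : {A : Set} → (List A → List A → Set) → (List A → List A → Set) → Set
Derivable R S = ∀ {l r} → R l r → Cong S l r

Cong-mono : {A : Set} {R S : List A → List A → Set} → Derivable R S →
            ∀ {w w'} → Cong R w w' → Cong S w w'
Cong-mono derive (step u l r v ρ) = inContext u v (derive ρ)
Cong-mono derive (c-refl w) = c-refl w
Cong-mono derive (c-sym c) = c-sym (Cong-mono derive c)
Cong-mono derive (c-trans c d) = c-trans (Cong-mono derive c) (Cong-mono derive d)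

mutuallyDerivable⇒Tietze : {A : Set} {R S : List A → List A → Set} →
  Derivable R S → Derivable S R → TietzeEquivalent R S
mutuallyDerivable⇒Tietze R⇒S S⇒R =
  (λ w → w) , (λ w → w) ,
  (λ _ _ → Cong-mono R⇒S) , (λ _ _ → Cong-mono S⇒R) ,
  c-refl [] , (λ _ _ → c-refl _) , c-refl [] , (λ _ _ → c-refl _) ,
  c-refl , c-refl

Col-≡ : ∀ {n} (a b : Col n) → proj₁ a ≡ proj₁ b → a ≡ b
Col-≡ (u , p) (.u , q) refl = cong (u ,_) (T-irrelevant p q)

module Columns {n : ℕ} where

  letter : (x : ℕ) → T (inRange n x) → Col n
  letter x p = [ x ] , ∧-join (∧-join p tt) tt

  spell : (u : List ℕ) → T (allB (inRange n) u) → Word n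
  spell [] _ = []
  spell (x ∷ u) p = letter x (proj₁ (∧-split p)) ∷ spell u (proj₂ (∧-split p))

  spell-columns : ∀ u p → map proj₁ (spell u p) ≡ map [_] u
  spell-columns [] _ = refl
  spell-columns (x ∷ u) p = cong ([ x ] ∷_) (spell-columns u (proj₂ (∧-split p)))

  letters : Col n → Word n
  letters ([] , ())
  letters ((x ∷ u) , p) = spell (x ∷ u) (proj₁ (∧-split p))

  letters-columns : ∀ c → map proj₁ (letters c) ≡ map [_] (proj₁ c)
  letters-columns ([] , ())
  letters-columns ((x ∷ u) , p) = spell-columns (x ∷ u) _

  tail-isCol : ∀ x y u → T (isCol n (x ∷ y ∷ u)) → T (isCol n (y ∷ u))
  tail-isCol x y u p with ∧-split {allB (inRange n) (x ∷ y ∷ u)} p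
  ... | inRange-xyu , decreasing-xyu =
    ∧-join (proj₂ (∧-split {inRange n x} inRange-xyu)) (proj₂ (∧-split {y <ᵇ x} decreasing-xyu))

open Columns

letters≈column : ∀ {n} (c : Col n) → Cong (CPCRel n) (letters c) (c ∷ [])
letters≈column ([] , ())
letters≈column {n} ((x ∷ []) , p) =
  subst (λ c → Cong (CPCRel n) (c ∷ []) (((x ∷ []) , p) ∷ [])) (Col-≡ _ _ refl) (c-refl _)
letters≈column ((x ∷ y ∷ u) , p) = relation (γ _ _ (s≤s (s≤s z≤n)) (letters-columns ((x ∷ y ∷ u) , p)))

-- α'_{x,u} holds in CPC₂(n): c_x c_u ≈ c_x c_{x_p} ⋯ c_{x_1} ≈ c_{xu} by γ_{xu}.
PreColRel⇒CPC : ∀ {n} → Derivable (PreColRel n) (CPCRel n)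
PreColRel⇒CPC (pc ρ) = relation (pc ρ)
PreColRel⇒CPC (α-x,u x cx ([] , ()) cxu _ _)
PreColRel⇒CPC (α-x,u x cx cu@((y ∷ u) , _) cxu cx≡x refl) =
  c-trans (prepend cx (c-sym (letters≈column cu)))
    (relation (γ cxu (cx ∷ letters cu) (s≤s (s≤s z≤n)) (cong₂ _∷_ cx≡x (letters-columns cu))))

-- In PreCol₂(n) any word spelling a column u reduces to c_u: induct on the
-- word, attaching the top letter with α'_{x,v} to the column v below it.
spelling≈column : ∀ {n} (w : Word n) (c : Col n) → map proj₁ w ≡ map [_] (proj₁ c) →
                  Cong (PreColRel n) w (c ∷ [])
spelling≈column w ([] , ())
spelling≈column [] ((x ∷ u) , p) ()
spelling≈column {n} (d ∷ []) ((x ∷ []) , p) e =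
  subst (λ c → Cong (PreColRel n) (d ∷ []) (c ∷ [])) (Col-≡ d _ (∷-injectiveˡ e)) (c-refl _)
spelling≈column (d ∷ []) ((x ∷ y ∷ u) , p) ()
spelling≈column (d ∷ d' ∷ w) ((x ∷ []) , p) ()
spelling≈column {n} (d ∷ d' ∷ w) ((x ∷ y ∷ u) , p) e =
  c-trans (prepend d (spelling≈column (d' ∷ w) below (∷-injectiveʳ e)))
    (relation (α-x,u x d below ((x ∷ y ∷ u) , p) (∷-injectiveˡ e) refl))
  where
  below : Col n
  below = (y ∷ u) , tail-isCol x y u p

CPCRel⇒PreCol : ∀ {n} → Derivable (CPCRel n) (PreColRel n)
CPCRel⇒PreCol (pc ρ) = relation (pc ρ)
CPCRel⇒PreCol (γ c w _ e) = spelling≈column w c e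

lemma2p3p6 : (n : ℕ) → 0 < n → TietzeEquivalent (PreColRel n) (CPCRel n)
lemma2p3p6 n _ = mutuallyDerivable⇒Tietze PreColRel⇒CPC CPCRel⇒PreCol
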